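{- Let $\mathcal{L}$ be a fragment as in the context with $\Diamond\in\mathcal{O}$, $\exists\notin\mathcal{O}$ and no action constructors (so the only actions are the relation symbols). Let $(\mathfrak{M},w)$ and $(\mathfrak{N},v)$ be image-finite pointed models over a signature $\Delta$. Then $(\mathfrak{M},w)$ and $(\mathfrak{N},v)$ are $\mathcal{L}$-elementarily equivalent if and only if they are $\omega$-bisimilar.
   Context: Hybrid-dynamic propositional logic (HDPL). A signature is $\Delta=((F,P),\mathtt{Prop})$ with $F$ nominals, $P$ binary relation symbols, $\mathtt{Prop}$ propositional symbols; $\Delta[x]$ adds a fresh nominal $x$. A $\Delta$-model $\mathfrak{M}$: a nonempty set $|\mathfrak{M}|$ of states, states $k^{\mathfrak{M}}$, relations $\lambda^{\mathfrak{M}}$, and $M(w)\subseteq\mathtt{Prop}$ per state; $\mathfrak{M}[x\leftarrow w]$ expands $\mathfrak{M}$ with $x$ interpreted as $w$. Actions: $\mathfrak{a}::=\lambda\mid\mathfrak{a}\cup\mathfrak{a}\mid\mathfrak{a};\mathfrak{a}\mid\mathfrak{a}^*$. Sentences: $\phi::=p\mid k\mid\bigwedge\Phi\mid\neg\phi\mid\langle\mathfrak{a}\rangle\phi\mid @_k\phi\mid{\downarrow}x.\phi_x\mid\exists x.\phi_x$ with standard satisfaction at pointed models ($\langle\mathfrak{a}\rangle\phi$: $\phi$ at some $\mathfrak{a}$-successor; $@_k\phi$: $\phi$ at $k^{\mathfrak{M}}$; ${\downarrow}x.\phi_x$: $(\mathfrak{M}[x\leftarrow w],w)\models\phi_x$;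 $\exists x.\phi_x$: for some state $u$, $(\mathfrak{M}[x\leftarrow u],w)\models\phi_x$). $\mathcal{L}$ is a fragment obtained by discarding some action constructors and/or some of the constructors $\Diamond$ (possibility), $@$, $\downarrow$, $\exists$; $\mathcal{O}$ is the set retained, $\mathcal{A}(\Delta)$ the $\mathcal{L}$-actions. Elementary equivalence: satisfying the same $\mathcal{L}$-sentences. Image-finite: $\lambda^{\mathfrak{M}}(u)$ finite for all states $u$ and $\lambda\in P$. $\omega$-bisimulation: a relation $B_\ell\subseteq(|\mathfrak{M}|^\ell\times|\mathfrak{M}|)\times(|\mathfrak{N}|^\ell\times|\mathfrak{N}|)$ is an $\ell$-bisimulation if for all $(\overline{w},w)\mathrel{B_\ell}(\overline{v},v)$: (prop) $p\in M(w)$ iff $p\in N(v)$; (nom) $w=k^{\mathfrak{M}}$ iff $v=k^{\mathfrak{N}}$; (wvar) $\overline{w}(j)=w$ iff $\overline{v}(j)=v$ ($1\le j\le\ell$); (forth) if $\Diamond\in\mathcal{O}$, for all $\mathfrak{a}\in\mathcal{A}(\Delta)$, $w'\in\mathfrak{a}^{\mathfrak{M}}(w)$ there is $v'\in\mathfrak{a}^{\mathfrak{N}}(v)$ with $(\overline{w},w')\mathrel{B_\ell}(\overline{v},v')$; (back) symmetric; (atv) if $@\in\mathcal{O}$, $(\overline{w},\overline{w}(j))\mathrel{B_\ell}(\overline{v},\overline{v}(j))$; (atn) if $@\in\mathcal{O}$, $(\overline{w},k^{\mathfrak{M}})\mathrel{B_\ell}(\overline{v},k^{\mathfrak{N}})$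 for all $k\in F$. An $\omega$-bisimulation is a family $(B_\ell)_{\ell\in\omega}$ of $\ell$-bisimulations such that whenever $(\overline{w},w)\mathrel{B_\ell}(\overline{v},v)$: (st) if $\downarrow\in\mathcal{O}$, $(\overline{w}\,w,w)\mathrel{B_{\ell+1}}(\overline{v}\,v,v)$ (juxtaposition = concatenation); (ex) if $\exists\in\mathcal{O}$, for all $w'$ some $v'$ has $(\overline{w}\,w',w)\mathrel{B_{\ell+1}}(\overline{v}\,v',v)$ and vice versa. $(\mathfrak{M},w),(\mathfrak{N},v)$ are $\omega$-bisimilar if some $\omega$-bisimulation has $w\mathrel{B_0}v$. -}

module Defs where

open import Level using (0ℓ)
open import Data.Bool using (Bool; T)
open import Data.Nat using (ℕ; zero; suc)
open import Data.Fin using (Fin)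
open import Data.Vec using (Vec; []; _∷ʳ_; lookup)
open import Data.List using (List)
open import Data.List.Relation.Unary.All using (All)
open import Data.List.Membership.Propositional using (_∈_)
open import Data.Product using (Σ; _×_; ∃)
open import Data.Sum using (_⊎_; inj₁; inj₂)
open import Function.Bundles using (_⇔_)
open import Relation.Nullary using (¬_)
open import Relation.Binary.PropositionalEquality using (_≡_)

record Signature : Set₁ where
  field
    Nom  : Set
    Rel  : Set
    Prp  : Set
open Signature public

record Model (Δ : Signature) : Set₁ where
  field
    State     : Set
    inhabited : State
    nom       : Nom Δ → State
    rel       : Rel Δ → State → State → Set
    val       : State → Prp Δ → Set
open Model public

ImageFinite : ∀ {Δ} → Model Δ → Set
ImageFinite {Δ} M =
  (λ' : Rel Δ) (u : State M) →
  ∃ λ (L : List (State M)) → (u' : State M) → (rel M λ' u u' ⇔ (u' ∈ L))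

-- The fragment L: ◇ ∈ O, ∃ ∉ O, no action constructors (actions = relation
-- symbols). The flags say whether @ and ↓ are retained.
record Fragment : Set where
  field
    hasAt    : Bool
    hasStore : Bool
open Fragment public

-- Nominals of Δ[x₁]…[x_ℓ]: those of Δ plus ℓ variables (x_{j+1} = inj₂ j).
NomV : Signature → ℕ → Set
NomV Δ ℓ = Nom Δ ⊎ Fin ℓ

-- L-sentences over Δ[x₁]…[x_ℓ]; ↓ binds the fresh variable x_{ℓ+1}.
data Sen (𝓛 : Fragment) (Δ : Signature) : ℕ → Set where
  prop  : ∀ {ℓ} → Prp Δ → Sen 𝓛 Δ ℓ
  nomS  : ∀ {ℓ} → NomV Δ ℓ → Sen 𝓛 Δ ℓ
  conj  : ∀ {ℓ} → List (Sen 𝓛 Δ ℓ) → Sen 𝓛 Δ ℓ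
  neg   : ∀ {ℓ} → Sen 𝓛 Δ ℓ → Sen 𝓛 Δ ℓ
  dia   : ∀ {ℓ} → Rel Δ → Sen 𝓛 Δ ℓ → Sen 𝓛 Δ ℓ
  at    : ∀ {ℓ} → T (hasAt 𝓛) → NomV Δ ℓ → Sen 𝓛 Δ ℓ → Sen 𝓛 Δ ℓ
  store : ∀ {ℓ} → T (hasStore 𝓛) → Sen 𝓛 Δ (suc ℓ) → Sen 𝓛 Δ ℓ

⟦_⟧N : ∀ {Δ ℓ} {M : Model Δ} → NomV Δ ℓ → Vec (State M) ℓ → State M
⟦_⟧N {M = M} (inj₁ k) ws = nom M k
⟦ inj₂ j ⟧N ws = lookup ws j

Sat : ∀ {𝓛 Δ ℓ} (M : Model Δ) → Vec (State M) ℓ → State M → Sen 𝓛 Δ ℓ → Set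
SatAll : ∀ {𝓛 Δ ℓ} (M : Model Δ) → Vec (State M) ℓ → State M → List (Sen 𝓛 Δ ℓ) → Set
Sat M ws w (prop p)      = val M w p
Sat M ws w (nomS k)      = w ≡ ⟦_⟧N {M = M} k ws
Sat {𝓛} M ws w (conj Φ) = SatAll {𝓛} M ws w Φ
Sat M ws w (neg φ)       = ¬ Sat M ws w φ
Sat M ws w (dia λ' φ)    = ∃ λ w' → rel M λ' w w' × Sat M ws w' φ
Sat M ws w (at _ k φ)    = Sat M ws (⟦_⟧N {M = M} k ws) φ
Sat M ws w (store _ φ)   = Sat M (ws ∷ʳ w) w φ
SatAll M ws w List.[]       = Data.Unit.⊤ where import Data.Unit
SatAll {𝓛} M ws w (φ List.∷ Φ) = Sat M ws w φ × SatAll {𝓛} M ws w Φ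

ElemEquiv : (𝓛 : Fragment) {Δ : Signature} (M N : Model Δ) → State M → State N → Set
ElemEquiv 𝓛 {Δ} M N w v = (φ : Sen 𝓛 Δ 0) → Sat M [] w φ ⇔ Sat N [] v φ

Family : ∀ {Δ} → Model Δ → Model Δ → Set₁
Family M N = (ℓ : ℕ) → Vec (State M) ℓ → State M → Vec (State N) ℓ → State N → Set

record IsLBisim (𝓛 : Fragment) {Δ : Signature} (M N : Model Δ) (B : Family M N) (ℓ : ℕ) : Set where
  field
    bprop  : ∀ {ws w vs v} → B ℓ ws w vs v → (p : Prp Δ) → val M w p ⇔ val N v p
    bnom   : ∀ {ws w vs v} → B ℓ ws w vs v → (k : Nom Δ) → (w ≡ nom M k) ⇔ (v ≡ nom N k)
    bwvar  : ∀ {ws w vs v} → B ℓ ws w vs v → (j : Fin ℓ) → (lookup ws j ≡ w) ⇔ (lookup vs j ≡ v)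
    bforth : ∀ {ws w vs v} → B ℓ ws w vs v → (λ' : Rel Δ) (w' : State M) → rel M λ' w w' →
             ∃ λ v' → rel N λ' v v' × B ℓ ws w' vs v'
    bback  : ∀ {ws w vs v} → B ℓ ws w vs v → (λ' : Rel Δ) (v' : State N) → rel N λ' v v' →
             ∃ λ w' → rel M λ' w w' × B ℓ ws w' vs v'
    batv   : ∀ {ws w vs v} → B ℓ ws w vs v → T (hasAt 𝓛) → (j : Fin ℓ) →
             B ℓ ws (lookup ws j) vs (lookup vs j)
    batn   : ∀ {ws w vs v} → B ℓ ws w vs v → T (hasAt 𝓛) → (k : Nom Δ) →
             B ℓ ws (nom M k) vs (nom N k)

-- ω-bisimulation (∃ ∉ O, so only the (st) condition)
record IsOmegaBisim (𝓛 : Fragment) {Δ : Signature} (M N : Model Δ) (B : Family M N) : Set where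
  field
    isL : (ℓ : ℕ) → IsLBisim 𝓛 M N B ℓ
    bst : ∀ {ℓ ws w vs v} → B ℓ ws w vs v → T (hasStore 𝓛) →
          B (suc ℓ) (ws ∷ʳ w) w (vs ∷ʳ v) v

OmegaBisimilar : (𝓛 : Fragment) {Δ : Signature} (M N : Model Δ) → State M → State N → Set₁
OmegaBisimilar 𝓛 M N w v = Σ (Family M N) λ B → IsOmegaBisim 𝓛 M N B × B 0 [] w [] v

-- Sentences are preserved along an ω-bisimulation, by induction on the sentence, with
-- (st) taking care of ↓ and (atv)/(atn) of @. Conversely, L-equivalence itself is an
-- ω-bisimulation; the only nontrivial clause is (forth), the Hennessy–Milner argument:
-- for each state u among the finitely many λ-successors of v choose a sentence that
-- holds at w' and fails at u unless u is equivalent to w'. The diamond of their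
-- conjunction holds at w, hence at v, so some successor satisfies its own separator.
module Submission where

open import Defs
open import Level using (0ℓ)
open import Axiom.ExcludedMiddle using (ExcludedMiddle)
open import Axiom.DoubleNegationElimination using (em⇒dne)
open import Data.Product using (_×_; _,_; proj₁; proj₂; Σ; ∃)
open import Data.Product.Function.NonDependent.Propositional using (_×-⇔_)
open import Data.Sum using (inj₁; inj₂)
open import Data.Nat using (ℕ)
open import Data.Vec using (Vec)
open import Data.List using (List; []; _∷_; map)
open import Data.List.Relation.Unary.All as All using (All; []; _∷_)
open import Data.List.Relation.Unary.All.Properties using (map⁺; map⁻)
open import Data.List.Membership.Propositional using (_∈_)
open import Data.Unit using (tt)
open import Data.Empty using (⊥-elim)
open import Function.Bundles using (_⇔_; mk⇔; Equivalence)
open import Function.Properties.Equivalence using () renaming (sym to ⇔-sym)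
open import Relation.Nullary using (¬_; yes; no)
open import Relation.Binary.PropositionalEquality using (_≡_; sym)

open Equivalence

¬-cong-⇔ : ∀ {A B : Set} → A ⇔ B → (¬ A) ⇔ (¬ B)
¬-cong-⇔ A⇔B = mk⇔ (λ ¬a b → ¬a (from A⇔B b)) (λ ¬b a → ¬b (to A⇔B a))

≡-flip-⇔ : ∀ {S T : Set} {s s' : S} {t t' : T} → (s ≡ s') ⇔ (t ≡ t') → (s' ≡ s) ⇔ (t' ≡ t)
≡-flip-⇔ e = mk⇔ (λ p → sym (to e (sym p))) (λ p → sym (from e (sym p)))

module _ {𝓛 : Fragment} {Δ : Signature} where

  satAll⇒all : ∀ {ℓ} (M : Model Δ) {ws w} (Φ : List (Sen 𝓛 Δ ℓ)) →
    SatAll {𝓛} M ws w Φ → All (Sat M ws w) Φ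
  satAll⇒all M []      _        = []
  satAll⇒all M (φ ∷ Φ) (s , ss) = s ∷ satAll⇒all M Φ ss

  all⇒satAll : ∀ {ℓ} (M : Model Δ) {ws w} {Φ : List (Sen 𝓛 Δ ℓ)} →
    All (Sat M ws w) Φ → SatAll {𝓛} M ws w Φ
  all⇒satAll M []       = tt
  all⇒satAll M (s ∷ ss) = s , all⇒satAll M ss

  Equivalent : (M N : Model Δ) → Family M N
  Equivalent M N ℓ ws w vs v = (φ : Sen 𝓛 Δ ℓ) → Sat M ws w φ ⇔ Sat N vs v φ

  Distinguishes : ∀ {M N : Model Δ} {ℓ} → Sen 𝓛 Δ ℓ →
    Vec (State M) ℓ → State M → Vec (State N) ℓ → State N → Set
  Distinguishes {M} {N} φ ws w vs v = Sat M ws w φ × ¬ Sat N vs v φ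

  module _ {M N : Model Δ} where

    equivalent-sym : ∀ {ℓ ws w vs v} → Equivalent M N ℓ ws w vs v → Equivalent N M ℓ vs v ws w
    equivalent-sym e φ = ⇔-sym (e φ)

    bisimilar⇒equivalent : (B : Family M N) → IsOmegaBisim 𝓛 M N B →
      ∀ {ℓ ws w vs v} → B ℓ ws w vs v → Equivalent M N ℓ ws w vs v
    bisimilar⇒equivalentAll : (B : Family M N) → IsOmegaBisim 𝓛 M N B →
      ∀ {ℓ ws w vs v} → B ℓ ws w vs v → (Φ : List (Sen 𝓛 Δ ℓ)) →
      SatAll {𝓛} M ws w Φ ⇔ SatAll {𝓛} N vs v Φ

    bisimilar⇒equivalent B isB {ℓ} b = λ where
        (prop p)           → bprop b p
        (nomS (inj₁ k))    → bnom b k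
        (nomS (inj₂ j))    → ≡-flip-⇔ (bwvar b j)
        (conj Φ)           → bisimilar⇒equivalentAll B isB b Φ
        (neg φ)            → ¬-cong-⇔ (bisimilar⇒equivalent B isB b φ)
        (dia λ' φ)         → mk⇔ (forth-sat φ) (back-sat φ)
        (at h (inj₁ k) φ)  → bisimilar⇒equivalent B isB (batn b h k) φ
        (at h (inj₂ j) φ)  → bisimilar⇒equivalent B isB (batv b h j) φ
        (store h φ)        → bisimilar⇒equivalent B isB (IsOmegaBisim.bst isB b h) φ
      where
      open IsLBisim (IsOmegaBisim.isL isB ℓ)
      forth-sat : ∀ {λ'} φ → Sat M _ _ (dia λ' φ) → Sat N _ _ (dia λ' φ)
      forth-sat {λ'} φ (w' , r , s) with bforth b λ' w' r
      ... | v' , r' , b' = v' , r' , to (bisimilar⇒equivalent B isB b' φ) s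
      back-sat : ∀ {λ'} φ → Sat N _ _ (dia λ' φ) → Sat M _ _ (dia λ' φ)
      back-sat {λ'} φ (v' , r , s) with bback b λ' v' r
      ... | w' , r' , b' = w' , r' , from (bisimilar⇒equivalent B isB b' φ) s

    bisimilar⇒equivalentAll B isB b []      = mk⇔ (λ _ → tt) (λ _ → tt)
    bisimilar⇒equivalentAll B isB b (φ ∷ Φ) =
      bisimilar⇒equivalent B isB b φ ×-⇔ bisimilar⇒equivalentAll B isB b Φ

  module _ (em : ExcludedMiddle 0ℓ) {M N : Model Δ} {ℓ : ℕ} where

    -- Closure under negation turns a sentence true only at (vs , v) into one true only at (ws , w).
    indistinguishable⇒equivalent : ∀ {ws w vs v} →
      ¬ (∃ λ (φ : Sen 𝓛 Δ ℓ) → Distinguishes {M} {N} φ ws w vs v) → Equivalent M N ℓ ws w vs v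
    indistinguishable⇒equivalent nd φ = mk⇔
      (λ s → em⇒dne em λ ¬t → nd (φ , s , ¬t))
      (λ t → em⇒dne em λ ¬s → nd (neg φ , ¬s , λ ¬t → ¬t t))

    separator : ∀ ws w vs u → Σ (Sen 𝓛 Δ ℓ) λ φ →
      Sat M ws w φ × (Sat N vs u φ → Equivalent M N ℓ ws w vs u)
    separator ws w vs u with em {∃ λ φ → Distinguishes {M} {N} φ ws w vs u}
    ... | yes (φ , s , ¬t) = φ , s , λ t → ⊥-elim (¬t t)
    ... | no nd            = conj [] , tt , λ _ → indistinguishable⇒equivalent nd

    equivalent-forth : ImageFinite N → ∀ {ws w vs v} → Equivalent M N ℓ ws w vs v →
      (λ' : Rel Δ) (w' : State M) → rel M λ' w w' →
      ∃ λ v' → rel N λ' v v' × Equivalent M N ℓ ws w' vs v'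
    equivalent-forth imN {ws} {w} {vs} {v} e λ' w' r =
      let v' , r' , sats = to (e (dia λ' (conj (map sep successors)))) (w' , r , seps-at-w')
      in v' , r' , proj₂ (proj₂ (separator ws w' vs v'))
                     (All.lookup (map⁻ (satAll⇒all N _ sats)) (to (enumerates v') r'))
      where
      successors : List (State N)
      successors = proj₁ (imN λ' v)
      enumerates : ∀ v' → rel N λ' v v' ⇔ (v' ∈ successors)
      enumerates = proj₂ (imN λ' v)
      sep : State N → Sen 𝓛 Δ ℓ
      sep u = proj₁ (separator ws w' vs u)
      seps-at-w' : SatAll {𝓛} M ws w' (map sep successors)
      seps-at-w' = all⇒satAll M (map⁺ (All.tabulate λ {u} _ → proj₁ (proj₂ (separator ws w' vs u))))

  equivalence-isOmegaBisim : ExcludedMiddle 0ℓ → {M N : Model Δ} →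
    ImageFinite M → ImageFinite N → IsOmegaBisim 𝓛 M N (Equivalent M N)
  equivalence-isOmegaBisim em imM imN = record
    { isL = λ ℓ → record
      { bprop  = λ e p → e (prop p)
      ; bnom   = λ e k → e (nomS (inj₁ k))
      ; bwvar  = λ e j → ≡-flip-⇔ (e (nomS (inj₂ j)))
      ; bforth = equivalent-forth em imN
      ; bback  = λ e λ' v' r → let w' , r' , e' = equivalent-forth em imM (equivalent-sym e) λ' v' r
                                in w' , r' , equivalent-sym e'
      ; batv   = λ e h j φ → e (at h (inj₂ j) φ)
      ; batn   = λ e h k φ → e (at h (inj₁ k) φ)
      }
    ; bst = λ e h φ → e (store h φ)
    }

mainTheorem8 : ExcludedMiddle 0ℓ →
    (𝓛 : Fragment) (Δ : Signature) (M N : Model Δ) (w : State M) (v : State N) →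
    ImageFinite M → ImageFinite N →
    (ElemEquiv 𝓛 M N w v → OmegaBisimilar 𝓛 M N w v) × (OmegaBisimilar 𝓛 M N w v → ElemEquiv 𝓛 M N w v)
mainTheorem8 em 𝓛 Δ M N w v imM imN =
  (λ ee → Equivalent M N , equivalence-isOmegaBisim em imM imN , ee) ,
  (λ { (B , isB , b) → bisimilar⇒equivalent B isB b })
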